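{- Let $D$ be a diagram with no empty columns, i.e., every column $c$ with $1\le c\le m$ contains a cell of $D$, where $m$ is the largest column index of a cell of $D$. Then $D$ is both northeast and southeast if and only if $D$ is a lock diagram (that is, $D=\mathrm{Lock}(\alpha)$ for some weak composition $\alpha$).
   Context: A diagram is a finite subset of $\mathbb{N}\times\mathbb{N}$; $(r,c)$ is a cell in row $r$, column $c$. $D$ is northeast if for all $(r_1,c_1),(r_2,c_2)\in D$, $(\max(r_1,r_2),\max(c_1,c_2))\in D$; $D$ is southeast if for all such pairs, $(\min(r_1,r_2),\max(c_1,c_2))\in D$. For a weak composition $\alpha=(\alpha_1,\dots,\alpha_n)\in\mathbb{Z}_{\ge0}^n$ with $m=\max_i\alpha_i$, the lock diagram $\mathrm{Lock}(\alpha)$ is the diagram with exactly $\alpha_i$ cells in row $i$ such that $(r,c)\in\mathrm{Lock}(\alpha)$ implies $(r,c+1)\in\mathrm{Lock}(\alpha)$ for all $1\le c<m$ (i.e., row $i$ occupies columns $m-\alpha_i+1,\dots,m$). -}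

module Defs where

open import Data.Nat using (ℕ; zero; suc; _≤_; _<_; _∸_; _⊔_; _⊓_)
open import Data.Product using (_×_; _,_; Σ; ∃; proj₁; proj₂)
open import Data.List using (List; length; lookup; foldr)
open import Data.List.Membership.Propositional using (_∈_)
open import Data.Fin using (Fin; toℕ)
open import Relation.Binary.PropositionalEquality using (_≡_)
open import Function.Bundles using (_⇔_)

-- A cell (r , c) : row r, column c.  Rows and columns are indexed from 1.
Cell : Set
Cell = ℕ × ℕ

-- A diagram is a finite set of cells, given by a finite list (duplicates
-- and order are irrelevant: only membership _∈_ is ever used).
Diagram : Set
Diagram = List Cell

-- All cells have positive row and column indices (ℕ = {1,2,...} in the paper).
PositiveCells : Diagram → Set
PositiveCells D = ∀ {r c} → (r , c) ∈ D → 1 ≤ r × 1 ≤ c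

Northeast : Diagram → Set
Northeast D = ∀ {r₁ c₁ r₂ c₂} → (r₁ , c₁) ∈ D → (r₂ , c₂) ∈ D →
              (r₁ ⊔ r₂ , c₁ ⊔ c₂) ∈ D

Southeast : Diagram → Set
Southeast D = ∀ {r₁ c₁ r₂ c₂} → (r₁ , c₁) ∈ D → (r₂ , c₂) ∈ D →
              (r₁ ⊓ r₂ , c₁ ⊔ c₂) ∈ D

maxCol : Diagram → ℕ
maxCol D = foldr (λ p acc → proj₂ p ⊔ acc) 0 D

NoEmptyColumns : Diagram → Set
NoEmptyColumns D = ∀ c → 1 ≤ c → c ≤ maxCol D → ∃ λ r → (r , c) ∈ D

WeakComposition : Set
WeakComposition = List ℕ

maxPart : WeakComposition → ℕ
maxPart α = foldr _⊔_ 0 α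

-- membership in Lock(α): row i = 1+toℕ j (1 ≤ i ≤ n) occupies columns
-- m - αᵢ + 1, …, m   (i.e. m ∸ αᵢ < c ≤ m), where m = max αᵢ.
InLock : WeakComposition → ℕ → ℕ → Set
InLock α r c = Σ (Fin (length α)) λ j →
  r ≡ suc (toℕ j) × maxPart α ∸ lookup α j < c × c ≤ maxPart α

IsLockOf : Diagram → WeakComposition → Set
IsLockOf D α = ∀ r c → ((r , c) ∈ D) ⇔ InLock α r c

IsLockDiagram : Diagram → Set
IsLockDiagram D = ∃ λ α → IsLockOf D α

-- Given NoEmptyColumns, NE ∧ SE amounts to every row being closed to the right
-- up to the last column m: for a cell (r , c) and c ≤ c′ ≤ m, take any cell
-- (r′ , c′) of column c′; SE (if r ≤ r′) or NE (if r′ ≤ r) of the two cells is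
-- (r , c′).  A row closed to the right inside 1 … m is an interval
-- m ∸ a < c ≤ m, so D = Lock(α) with αᵢ the length of row i, and max α = m
-- because column 1 is occupied.  Conversely, in a diagram whose rows are closed
-- to the right, (r₁ ⊔ r₂ , c₁ ⊔ c₂) and (r₁ ⊓ r₂ , c₁ ⊔ c₂) lie in the row of
-- one of the two given cells, to its right.
module Submission where

open import Defs
open import Data.Product using (_×_)
open import Function.Bundles using (_⇔_)

open import Data.Nat
open import Data.Nat.Properties
open import Data.Product using (∃; _,_; proj₁; proj₂)
open import Data.Product.Properties using (≡-dec)
open import Data.Sum using (_⊎_; inj₁; inj₂)
open import Data.Empty using (⊥-elim)
open import Data.List using (List; []; _∷_; foldr; applyUpTo)
open import Data.List.Properties using (length-applyUpTo; lookup-applyUpTo)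
open import Data.List.Relation.Unary.Any using (here; there)
open import Data.List.Membership.Propositional using (_∈_)
open import Data.List.Membership.Propositional.Properties
  using (∈-applyUpTo⁺; ∈-applyUpTo⁻)
open import Data.List.Membership.DecPropositional (≡-dec _≟_ _≟_) using (_∈?_)
open import Data.Fin using (toℕ; fromℕ<)
open import Data.Fin.Properties using (toℕ<n; toℕ-fromℕ<)
open import Relation.Nullary using (¬_; yes; no)
open import Relation.Unary using (Decidable)
open import Relation.Binary.PropositionalEquality
open import Function.Bundles using (mk⇔; Equivalence)
open import Function.Base using (id)

maxOf : {A : Set} → (A → ℕ) → List A → ℕ
maxOf g = foldr (λ x acc → g x ⊔ acc) 0

∈⇒≤maxOf : ∀ {A : Set} (g : A → ℕ) {x xs} → x ∈ xs → g x ≤ maxOf g xs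
∈⇒≤maxOf g {x} (here refl) = m≤m⊔n (g x) _
∈⇒≤maxOf g {xs = y ∷ _} (there x∈) = ≤-trans (∈⇒≤maxOf g x∈) (m≤n⊔m (g y) _)

maxOf-lub : ∀ {A : Set} (g : A → ℕ) xs {b} →
  (∀ {x} → x ∈ xs → g x ≤ b) → maxOf g xs ≤ b
maxOf-lub g []       bound = z≤n
maxOf-lub g (x ∷ xs) bound = ⊔-lub (bound (here refl)) (maxOf-lub g xs (λ x∈ → bound (there x∈)))

maxRow : Diagram → ℕ
maxRow = maxOf proj₁

RightClosedUpTo : ℕ → Diagram → Set
RightClosedUpTo b D = ∀ {r c c′} → (r , c) ∈ D → c ≤ c′ → c′ ≤ b → (r , c′) ∈ D

module _ {D : Diagram} {b : ℕ} (bounded : ∀ {r c} → (r , c) ∈ D → c ≤ b)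
         (closed : RightClosedUpTo b D) where

  private
    ∈-row-of-either : ∀ {r₁ c₁ r₂ c₂ r} → (r₁ , c₁) ∈ D → (r₂ , c₂) ∈ D →
      r ≡ r₁ ⊎ r ≡ r₂ → (r , c₁ ⊔ c₂) ∈ D
    ∈-row-of-either p q (inj₁ refl) = closed p (m≤m⊔n _ _) (⊔-lub (bounded p) (bounded q))
    ∈-row-of-either p q (inj₂ refl) = closed q (m≤n⊔m _ _) (⊔-lub (bounded p) (bounded q))

  rightClosed⇒northeast : Northeast D
  rightClosed⇒northeast {r₁} {_} {r₂} p q = ∈-row-of-either p q (⊔-sel r₁ r₂)

  rightClosed⇒southeast : Southeast D
  rightClosed⇒southeast {r₁} {_} {r₂} p q = ∈-row-of-either p q (⊓-sel r₁ r₂)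

northeast∧southeast⇒rightClosed : ∀ {D} → PositiveCells D → NoEmptyColumns D →
  Northeast D → Southeast D → RightClosedUpTo (maxCol D) D
northeast∧southeast⇒rightClosed {D} pos nec ne se {r} {c} {c′} p c≤c′ c′≤m
  with nec c′ (≤-trans (proj₂ (pos p)) c≤c′) c′≤m
... | r′ , q with ≤-total r r′
...   | inj₁ r≤r′ = subst (_∈ D) (cong₂ _,_ (m≤n⇒m⊓n≡m r≤r′) (m≤n⇒m⊔n≡n c≤c′)) (se p q)
...   | inj₂ r′≤r = subst (_∈ D) (cong₂ _,_ (m≥n⇒m⊔n≡m r′≤r) (m≤n⇒m⊔n≡n c≤c′)) (ne p q)

module _ {P : ℕ → Set} (P? : Decidable P) where

  leastOrNoneBelow : ∀ n →
    (∀ {c} → c < n → ¬ P c) ⊎ ∃ λ lo → P lo × (∀ {c} → c < lo → ¬ P c)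
  leastOrNoneBelow zero = inj₁ λ ()
  leastOrNoneBelow (suc n) with leastOrNoneBelow n
  ... | inj₂ least = inj₂ least
  ... | inj₁ none with P? n
  ...   | yes pn = inj₂ (n , pn , none)
  ...   | no ¬pn = inj₁ noneBelowSuc
    where
    noneBelowSuc : ∀ {c} → c < suc n → ¬ P c
    noneBelowSuc c<1+n with m≤n⇒m<n∨m≡n (s≤s⁻¹ c<1+n)
    ... | inj₁ c<n  = none c<n
    ... | inj₂ refl = ¬pn

  upwardClosed⇒suffix : ∀ m → (∀ {c} → P c → 1 ≤ c × c ≤ m) →
    (∀ {c c′} → P c → c ≤ c′ → c′ ≤ m → P c′) →
    ∃ λ a → a ≤ m × (∀ c → P c ⇔ (m ∸ a < c × c ≤ m))
  upwardClosed⇒suffix m bounds closed with leastOrNoneBelow (suc m)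
  ... | inj₁ none = 0 , z≤n , λ c → mk⇔
        (λ pc → ⊥-elim (none (s≤s (proj₂ (bounds pc))) pc))
        (λ (m<c , c≤m) → ⊥-elim (<⇒≱ m<c c≤m))
  ... | inj₂ (zero , p₀ , _) with proj₁ (bounds p₀)
  ...   | ()
  upwardClosed⇒suffix m bounds closed | inj₂ (suc l , pl , below) =
    m ∸ l , m∸n≤m m l , λ c → mk⇔
      (λ pc → subst (_< c) (sym m∸[m∸l]≡l) (≮⇒≥ (λ c<1+l → below c<1+l pc)) ,
              proj₂ (bounds pc))
      (λ (lower , c≤m) → closed pl (subst (_< c) m∸[m∸l]≡l lower) c≤m)
    where
    m∸[m∸l]≡l : m ∸ (m ∸ l) ≡ l
    m∸[m∸l]≡l = m∸[m∸n]≡n (≤-trans (n≤1+n l) (proj₂ (bounds pl)))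

lock⇒columnsBounded : ∀ {D} α → IsLockOf D α → ∀ {r c} → (r , c) ∈ D → c ≤ maxPart α
lock⇒columnsBounded α iso p = proj₂ (proj₂ (proj₂ (Equivalence.to (iso _ _) p)))

lock⇒rightClosed : ∀ {D} α → IsLockOf D α → RightClosedUpTo (maxPart α) D
lock⇒rightClosed α iso p c≤c′ c′≤M with Equivalence.to (iso _ _) p
... | j , r≡ , lower , _ = Equivalence.from (iso _ _) (j , r≡ , <-≤-trans lower c≤c′ , c′≤M)

inLock-applyUpTo : ∀ f n {i c} → let M = maxPart (applyUpTo f n) in
  InLock (applyUpTo f n) (suc i) c ⇔ (i < n × M ∸ f i < c × c ≤ M)
inLock-applyUpTo f n {i} {c} = mk⇔
  (λ { (j , refl , lower , c≤M) →
       subst (toℕ j <_) (length-applyUpTo f n) (toℕ<n j) ,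
       subst (λ x → M ∸ x < c) (lookup-applyUpTo f n j) lower , c≤M })
  (λ (i<n , lower , c≤M) →
     let i<length = subst (i <_) (sym (length-applyUpTo f n)) i<n
         toℕj≡i   = toℕ-fromℕ< i<length
         lookup≡  = trans (lookup-applyUpTo f n (fromℕ< i<length)) (cong f toℕj≡i)
     in fromℕ< i<length , cong suc (sym toℕj≡i) ,
        subst (λ x → M ∸ x < c) (sym lookup≡) lower , c≤M)
  where M = maxPart (applyUpTo f n)

northeast∧southeast⇒lock : ∀ {D} → PositiveCells D → NoEmptyColumns D →
  Northeast D → Southeast D → IsLockDiagram D
northeast∧southeast⇒lock {D} pos nec ne se = α , isLockOf
  where
  m = maxCol D

  rowSuffix : ∀ r → ∃ λ a → a ≤ m × (∀ c → (r , c) ∈ D ⇔ (m ∸ a < c × c ≤ m))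
  rowSuffix r = upwardClosed⇒suffix (λ c → (r , c) ∈? D) m
    (λ p → proj₂ (pos p) , ∈⇒≤maxOf proj₂ p)
    (northeast∧southeast⇒rightClosed pos nec ne se)

  rowLength : ℕ → ℕ
  rowLength r = proj₁ (rowSuffix r)

  rowSuffix-to : ∀ r {c} → (r , c) ∈ D → m ∸ rowLength r < c × c ≤ m
  rowSuffix-to r {c} = Equivalence.to (proj₂ (proj₂ (rowSuffix r)) c)

  rowSuffix-from : ∀ r {c} → m ∸ rowLength r < c × c ≤ m → (r , c) ∈ D
  rowSuffix-from r {c} = Equivalence.from (proj₂ (proj₂ (rowSuffix r)) c)

  α : WeakComposition
  α = applyUpTo (λ i → rowLength (suc i)) (maxRow D)

  maxPart≤m : maxPart α ≤ m
  maxPart≤m = maxOf-lub id α λ x∈α → rowLength≤m (∈-applyUpTo⁻ _ x∈α)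
    where
    rowLength≤m : ∀ {x} → ∃ (λ i → i < maxRow D × x ≡ rowLength (suc i)) → x ≤ m
    rowLength≤m (i , _ , refl) = proj₁ (proj₂ (rowSuffix (suc i)))

  m≤maxPart : m ≤ maxPart α
  m≤maxPart = ≤-fromPositive λ 1≤m → fullRow (nec 1 ≤-refl 1≤m)
    where
    ≤-fromPositive : ∀ {k n} → (1 ≤ k → k ≤ n) → k ≤ n
    ≤-fromPositive {zero}  _ = z≤n
    ≤-fromPositive {suc k} h = h (s≤s z≤n)

    fullRow : (∃ λ r → (r , 1) ∈ D) → m ≤ maxPart α
    fullRow (zero , p)  = ⊥-elim (<-irrefl refl (proj₁ (pos p)))
    fullRow (suc i , p) = begin
      m                 ≤⟨ m∸n≡0⇒m≤n (n<1⇒n≡0 (proj₁ (rowSuffix-to (suc i) p))) ⟩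
      rowLength (suc i) ≤⟨ ∈⇒≤maxOf id (∈-applyUpTo⁺ _ (∈⇒≤maxOf proj₁ p)) ⟩
      maxPart α         ∎
      where open ≤-Reasoning

  maxPart≡m : maxPart α ≡ m
  maxPart≡m = ≤-antisym maxPart≤m m≤maxPart

  isLockOf : IsLockOf D α
  isLockOf zero c = mk⇔ (λ p → ⊥-elim (<-irrefl refl (proj₁ (pos p)))) λ { (_ , () , _) }
  isLockOf (suc i) c = mk⇔
    (λ p → Equivalence.from (inLock-applyUpTo _ (maxRow D))
             (∈⇒≤maxOf proj₁ p , subst (λ M → M ∸ rowLength (suc i) < c × c ≤ M)
                                     (sym maxPart≡m) (rowSuffix-to (suc i) p)))
    (λ inLock → let (_ , row) = Equivalence.to (inLock-applyUpTo _ (maxRow D)) inLock in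
       rowSuffix-from (suc i) (subst (λ M → M ∸ rowLength (suc i) < c × c ≤ M) maxPart≡m row))

lemma2p3 : (D : Diagram) → PositiveCells D → NoEmptyColumns D →
    ((Northeast D × Southeast D) ⇔ IsLockDiagram D)
lemma2p3 D pos nec = mk⇔
  (λ (ne , se) → northeast∧southeast⇒lock pos nec ne se)
  (λ (α , isLock) → let bounded = lock⇒columnsBounded α isLock
                        closed  = lock⇒rightClosed α isLock
                    in rightClosed⇒northeast bounded closed , rightClosed⇒southeast bounded closed)
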